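{- Let $a, b \ge 2$ be integers. Let $d$ be the smallest positive divisor of $a$ such that $\gcd(a/d, b) = 1$, and suppose that $\log(d)/\log(b)$ is irrational. Then there exists $C > 0$, depending only on $a$ and $b$, such that $c_b(a^n) > C \log n$ for all sufficiently large integers $n$.
   Context: For an integer $b \ge 2$ and a nonnegative integer $N$, $c_b(N)$ denotes the number of nonzero digits in the base-$b$ expansion of $N$. $\log$ denotes the natural logarithm. -}

module Defs where

open import Data.Nat using (ℕ; zero; suc; _+_; _*_; _^_; _≤_; _<_; _/_; _%_)
open import Data.Nat.GCD using (gcd)
open import Data.Nat.Divisibility using (_∣_)
open import Data.Product using (Σ; _×_)
open import Relation.Binary.PropositionalEquality using (_≡_)
open import Relation.Nullary using (¬_)

-- Number of nonzero base-b digits of N, c_b(N), for b ≥ 2.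
-- The first argument of 'go' is fuel; N itself suffices (N has at most N digits).
-- For b < 2 (outside the paper's scope) the value is set to 0.
cb : ℕ → ℕ → ℕ
cb zero N = 0
cb (suc zero) N = 0
cb (suc (suc k)) N = go N N
  where
  go : ℕ → ℕ → ℕ
  go zero m = 0
  go (suc f) zero = 0
  go (suc f) (suc m) with (suc m) % suc (suc k)
  ... | zero  = go f (suc m / suc (suc k))
  ... | suc _ = suc (go f (suc m / suc (suc k)))

Admissible : ℕ → ℕ → ℕ → Set
Admissible a b d = (1 ≤ d) × Σ ℕ (λ q → (a ≡ q * d) × (gcd q b ≡ 1))

IsSmallestCoprimeCofactorDivisor : ℕ → ℕ → ℕ → Set
IsSmallestCoprimeCofactorDivisor a b d =
  Admissible a b d × (∀ e → Admissible a b e → d ≤ e)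

-- log(d)/log(b) is rational (for d ≥ 1, b ≥ 2) iff d^q = b^p for some
-- naturals p, q with q ≥ 1 (p = 0 covers d = 1, i.e. log d = 0).
LogRatioRational : ℕ → ℕ → Set
LogRatioRational d b = Σ ℕ (λ p → Σ ℕ (λ q → (1 ≤ q) × (d ^ q ≡ b ^ p)))

LogRatioIrrational : ℕ → ℕ → Set
LogRatioIrrational d b = ¬ LogRatioRational d b

{-# OPTIONS --safe #-}

-- Write a = q d with gcd q b = 1. By minimality of d every prime factor of d divides b. Pick a
-- prime p ∣ b minimising e/f, where e = ν_p(d) and f = ν_p(b); then b^e ∣ d^f, and d^f = F b^e
-- with p ∤ F, while F ≠ 1 by irrationality, so F has a prime factor g, which divides d and
-- hence b. For n = r + t f this gives a^n = X b^(e t) with X = q^n d^r F^t, where g^t ∣ X but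
-- b^(f e + 1) ∤ X because ν_p(X) = r e. Such an X has many nonzero digits: if b^J ∤ X, J ≤ s
-- and s b ≤ t, then X has a nonzero digit in positions [s, s b), for otherwise X mod b^(s b)
-- = X mod b^s would be a multiple of g^(s b) ≥ b^s, hence 0, and b^(s b) ∣ X. Iterating
-- s ↦ s b from s = J gives c_b(X) ≥ log_b (t / J), and t grows linearly in n.
module Submission where

open import Defs
open import Data.Nat
open import Data.Nat.Properties
open import Data.Nat.DivMod
open import Data.Nat.Divisibility
open import Data.Nat.GCD using (gcd-greatest)
open import Data.Nat.Coprimality
  using (Coprime; coprime-divisor; 1-coprimeTo; coprime⇒gcd≡1; gcd≡1⇒coprime)
import Data.Nat.Coprimality as Coprimality
open import Data.Nat.Induction using (<-rec)
open import Data.Nat.Primality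
open import Data.Nat.Primality.Factorisation using (factorise)
open import Data.Nat.ListAction using (product)
open import Data.List using ([]; _∷_)
open import Data.List.Relation.Unary.All using (_∷_)
open import Algebra.Properties.CommutativeSemigroup *-commutativeSemigroup
  using (interchange; xy∙z≈xz∙y; x∙yz≈xz∙y)
open import Data.Product using (Σ; _×_; _,_)
open import Data.Sum using (_⊎_; inj₁; inj₂)
open import Relation.Nullary using (¬_; yes; no; contradiction)
open import Relation.Nullary.Decidable using (_×-dec_)
open import Relation.Unary using (Decidable)
open import Relation.Binary.PropositionalEquality
  using (_≡_; refl; sym; trans; cong; cong₂; subst; subst₂; module ≡-Reasoning)

n<m^n : ∀ {m} n → 2 ≤ m → n < m ^ n
n<m^n zero    _   = s≤s z≤n
n<m^n {m} (suc n) 2≤m = begin-strict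
  suc n          ≤⟨ n<m^n n 2≤m ⟩
  m ^ n          <⟨ m<m+n (m ^ n) (≤-trans (s≤s z≤n) (n<m^n n 2≤m)) ⟩
  m ^ n + m ^ n  ≡⟨ cong (m ^ n +_) (+-identityʳ (m ^ n)) ⟨
  2 * m ^ n      ≤⟨ *-monoˡ-≤ (m ^ n) 2≤m ⟩
  m ^ suc n      ∎
  where open ≤-Reasoning

m*n^c≤2^[[m+n]*c] : ∀ m n c → 0 < c → m * n ^ c ≤ 2 ^ ((m + n) * c)
m*n^c≤2^[[m+n]*c] m n c 0<c = begin
  m * n ^ c              ≤⟨ *-mono-≤ m≤2^mc n^c≤2^nc ⟩
  2 ^ (m * c) * 2 ^ (n * c) ≡⟨ ^-distribˡ-+-* 2 (m * c) (n * c) ⟨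
  2 ^ (m * c + n * c)    ≡⟨ cong (2 ^_) (*-distribʳ-+ c m n) ⟨
  2 ^ ((m + n) * c)      ∎
  where
  open ≤-Reasoning
  m≤2^mc : m ≤ 2 ^ (m * c)
  m≤2^mc = ≤-trans (<⇒≤ (n<m^n m ≤-refl)) (^-monoʳ-≤ 2 (m≤m*n m c {{>-nonZero 0<c}}))
  n^c≤2^nc : n ^ c ≤ 2 ^ (n * c)
  n^c≤2^nc = ≤-trans (^-monoˡ-≤ c (<⇒≤ (n<m^n n ≤-refl))) (≤-reflexive (^-*-assoc 2 n c))

^-distribʳ-* : ∀ m n k → (m * n) ^ k ≡ m ^ k * n ^ k
^-distribʳ-* m n zero    = refl
^-distribʳ-* m n (suc k) = trans (cong (m * n *_) (^-distribʳ-* m n k)) (interchange m n (m ^ k) (n ^ k))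

^-split : ∀ {d f F} b e r t → d ^ f ≡ F * b ^ e → d ^ (r + t * f) ≡ d ^ r * F ^ t * b ^ (e * t)
^-split {d} {f} {F} b e r t d^f≡F*b^e = begin
  d ^ (r + t * f)                  ≡⟨ ^-distribˡ-+-* d r (t * f) ⟩
  d ^ r * d ^ (t * f)              ≡⟨ cong (λ i → d ^ r * d ^ i) (*-comm t f) ⟩
  d ^ r * d ^ (f * t)              ≡⟨ cong (d ^ r *_) (^-*-assoc d f t) ⟨
  d ^ r * (d ^ f) ^ t              ≡⟨ cong (λ x → d ^ r * x ^ t) d^f≡F*b^e ⟩
  d ^ r * (F * b ^ e) ^ t          ≡⟨ cong (d ^ r *_) (^-distribʳ-* F (b ^ e) t) ⟩
  d ^ r * (F ^ t * (b ^ e) ^ t)    ≡⟨ cong (λ x → d ^ r * (F ^ t * x)) (^-*-assoc b e t) ⟩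
  d ^ r * (F ^ t * b ^ (e * t))    ≡⟨ *-assoc (d ^ r) (F ^ t) (b ^ (e * t)) ⟨
  d ^ r * F ^ t * b ^ (e * t)      ∎
  where open ≡-Reasoning

frac-≤-trans : ∀ a b c d e f → 0 < d → a * d ≤ c * b → c * f ≤ e * d → a * f ≤ e * b
frac-≤-trans a b c d e f 0<d ad≤cb cf≤ed = *-cancelʳ-≤ (a * f) (e * b) d {{>-nonZero 0<d}} (begin
  a * f * d  ≡⟨ xy∙z≈xz∙y a f d ⟩
  a * d * f  ≤⟨ *-monoˡ-≤ f ad≤cb ⟩
  c * b * f  ≡⟨ xy∙z≈xz∙y c b f ⟩
  c * f * b  ≤⟨ *-monoˡ-≤ b cf≤ed ⟩
  e * d * b  ≡⟨ xy∙z≈xz∙y e d b ⟩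
  e * b * d  ∎)
  where open ≤-Reasoning

^-monoˡ-∣ : ∀ {m n} o → m ∣ n → m ^ o ∣ n ^ o
^-monoˡ-∣ zero    _   = ∣-refl
^-monoˡ-∣ (suc o) m∣n = *-pres-∣ m∣n (^-monoˡ-∣ o m∣n)

^-monoʳ-∣ : ∀ m {i j} → i ≤ j → m ^ i ∣ m ^ j
^-monoʳ-∣ m {i} {j} i≤j = divides (m ^ (j ∸ i)) (begin
  m ^ j              ≡⟨ cong (m ^_) (m+[n∸m]≡n i≤j) ⟨
  m ^ (i + (j ∸ i))  ≡⟨ ^-distribˡ-+-* m i (j ∸ i) ⟩
  m ^ i * m ^ (j ∸ i) ≡⟨ *-comm (m ^ i) (m ^ (j ∸ i)) ⟩
  m ^ (j ∸ i) * m ^ i ∎)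
  where open ≡-Reasoning

∣∧<⇒≡0 : ∀ {d r} → d ∣ r → r < d → r ≡ 0
∣∧<⇒≡0 {r = zero}  _   _   = refl
∣∧<⇒≡0 {r = suc _} d∣r r<d = contradiction d∣r (>⇒∤ r<d)

-- Digits in base b

module BaseDigits (k : ℕ) where
  b : ℕ
  b = suc (suc k)

  -- cb counts digits with a fuelled helper local to its definition, which cannot be named.
  -- fuelledCount is that helper, solved for by unification: the withs in cb-unfold turn its
  -- arguments into distinct variables. 1 ⊓ r is 0 if r ≡ 0 and 1 otherwise.
  mutual
    fuelledCount : ℕ → ℕ → ℕ → ℕ
    fuelledCount = _

    cb-unfold : ∀ x → cb b (suc x) ≡ 1 ⊓ (suc x % b) + fuelledCount (suc x) x (suc x / b)
    cb-unfold x with suc x % b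
    ... | zero with suc x / b | suc x
    ...   | y | N = refl
    cb-unfold x | suc _ = refl

  fuelledCount-suc : ∀ N f x → fuelledCount N (suc f) (suc x) ≡
    1 ⊓ (suc x % b) + fuelledCount N f (suc x / b)
  fuelledCount-suc N f x with suc x % b
  ... | zero  = refl
  ... | suc _ = refl

  suc/b≤ : ∀ x → suc x / b ≤ x
  suc/b≤ x = <⇒≤pred (m/n<m (suc x) b (s≤s (s≤s z≤n)))

  fuelledCount-fuelIrrelevant : ∀ N N' {f f'} x → x ≤ f → x ≤ f' →
                                fuelledCount N f x ≡ fuelledCount N' f' x
  fuelledCount-fuelIrrelevant N N' {zero}  {zero}  zero _ _ = refl
  fuelledCount-fuelIrrelevant N N' {zero}  {suc _} zero _ _ = refl
  fuelledCount-fuelIrrelevant N N' {suc _} {zero}  zero _ _ = refl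
  fuelledCount-fuelIrrelevant N N' {suc _} {suc _} zero _ _ = refl
  fuelledCount-fuelIrrelevant N N' {suc f} {suc f'} (suc x) (s≤s x≤f) (s≤s x≤f') = begin
    fuelledCount N (suc f) (suc x)                    ≡⟨ fuelledCount-suc N f x ⟩
    1 ⊓ (suc x % b) + fuelledCount N f (suc x / b)
      ≡⟨ cong (1 ⊓ (suc x % b) +_) (fuelledCount-fuelIrrelevant N N' (suc x / b)
                                     (≤-trans (suc/b≤ x) x≤f) (≤-trans (suc/b≤ x) x≤f')) ⟩
    1 ⊓ (suc x % b) + fuelledCount N' f' (suc x / b)  ≡⟨ fuelledCount-suc N' f' x ⟨
    fuelledCount N' (suc f') (suc x)                  ∎
    where open ≡-Reasoning

  cb-suc : ∀ x → cb b (suc x) ≡ 1 ⊓ (suc x % b) + cb b (suc x / b)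
  cb-suc x = trans (cb-unfold x)
    (cong (1 ⊓ (suc x % b) +_)
          (fuelledCount-fuelIrrelevant (suc x) (suc x / b) (suc x / b) (suc/b≤ x) ≤-refl))

  b^≢0 : ∀ i → NonZero (b ^ i)
  b^≢0 i = m^n≢0 b i

  -- Instance search cannot find NonZero (b ^ i) by itself.
  infixl 7 _/b^_
  _/b^_ : ℕ → ℕ → ℕ
  y /b^ i = _/_ y (b ^ i) {{b^≢0 i}}

  cb-/b≤ : ∀ y → cb b (y / b) ≤ cb b y
  cb-/b≤ zero    = z≤n
  cb-/b≤ (suc x) rewrite cb-suc x = m≤n+m _ _

  cb-b∣ : ∀ {y} → b ∣ y → cb b y ≡ cb b (y / b)
  cb-b∣ {zero}  _   = refl
  cb-b∣ {suc x} b∣y =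
    trans (cb-suc x) (cong (λ r → 1 ⊓ r + cb b (suc x / b)) (n∣m⇒m%n≡0 (suc x) b b∣y))

  cb-b∤ : ∀ {y} → ¬ b ∣ y → cb b y ≡ suc (cb b (y / b))
  cb-b∤ {zero}  b∤y = contradiction (b ∣0) b∤y
  cb-b∤ {suc x} b∤y with suc x % b in r≡ | cb-suc x
  ... | zero  | _  = contradiction (m%n≡0⇒n∣m (suc x) b r≡) b∤y
  ... | suc _ | eq = eq

  cb-*b : ∀ y → cb b (y * b) ≡ cb b y
  cb-*b y = trans (cb-b∣ (n∣m*n y)) (cong (cb b) (m*n/n≡m y b))

  cb-*b^ : ∀ i y → cb b (y * b ^ i) ≡ cb b y
  cb-*b^ zero    y = cong (cb b) (*-identityʳ y)
  cb-*b^ (suc i) y = begin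
    cb b (y * (b * b ^ i))  ≡⟨ cong (λ z → cb b (y * z)) (*-comm b (b ^ i)) ⟩
    cb b (y * (b ^ i * b))  ≡⟨ cong (cb b) (*-assoc y (b ^ i) b) ⟨
    cb b (y * b ^ i * b)    ≡⟨ cb-*b (y * b ^ i) ⟩
    cb b (y * b ^ i)        ≡⟨ cb-*b^ i y ⟩
    cb b y                  ∎
    where open ≡-Reasoning

  /b^suc : ∀ y i → y /b^ suc i ≡ y / b /b^ i
  /b^suc y i = sym (m/n/o≡m/[n*o] y b (b ^ i) {{_}} {{b^≢0 i}} {{m^n≢0 b (suc i)}})

  cb-/b^≤ : ∀ i y → cb b (y /b^ i) ≤ cb b y
  cb-/b^≤ zero    y = ≤-reflexive (cong (cb b) (n/1≡n y))
  cb-/b^≤ (suc i) y rewrite /b^suc y i = ≤-trans (cb-/b^≤ i (y / b)) (cb-/b≤ y)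

  cb-/b^< : ∀ m y → ¬ b ^ m ∣ y → cb b (y /b^ m) < cb b y
  cb-/b^< zero    y b^0∤y = contradiction (1∣ y) b^0∤y
  cb-/b^< (suc m) y b^m+1∤y rewrite /b^suc y m with b ∣? y
  ... | no  b∤y rewrite cb-b∤ b∤y = s≤s (cb-/b^≤ m (y / b))
  ... | yes b∣y rewrite cb-b∣ b∣y =
    cb-/b^< m (y / b) (λ b^m∣y/b → b^m+1∤y (m∣n/o⇒o*m∣n b∣y b^m∣y/b))

  cb>0 : ∀ {y} → 0 < y → 0 < cb b y
  cb>0 {y} 0<y = ≤-trans z<s (cb-/b^< y y (>⇒∤ {{>-nonZero 0<y}} (n<m^n y (s≤s (s≤s z≤n)))))

  /b^-+ : ∀ y i j → y /b^ i /b^ j ≡ y /b^ (i + j)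
  /b^-+ y i j = trans (m/n/o≡m/[n*o] y (b ^ i) (b ^ j) {{b^≢0 i}} {{b^≢0 j}} {{b^i*b^j≢0}})
                      (/-congʳ {{b^i*b^j≢0}} {{b^≢0 (i + j)}} (sym (^-distribˡ-+-* b i j)))
    where
    b^i*b^j≢0 : NonZero (b ^ i * b ^ j)
    b^i*b^j≢0 = m*n≢0 (b ^ i) (b ^ j) {{b^≢0 i}} {{b^≢0 j}}

  -- The lowest i digits of y then form a multiple of g ^ (i + m) below b ^ i ≤ g ^ (i + m),
  -- so they vanish.
  b^∣/b^⇒b^∣ : ∀ {g y} i m → g ∣ b → b ^ i ≤ g ^ (i + m) → g ^ (i + m) ∣ y →
               b ^ m ∣ y /b^ i → b ^ (i + m) ∣ y
  b^∣/b^⇒b^∣ {g} {y} i m g∣b b^i≤g^i+m g^i+m∣y b^m∣y/b^i =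
    subst (_∣ y) (sym (^-distribˡ-+-* b i m)) (m∣n/o⇒o*m∣n b^i∣y b^m∣y/b^i)
    where
    instance _ = b^≢0 i
    high : ℕ
    high = y /b^ i * b ^ i
    b^i+m∣high : b ^ (i + m) ∣ high
    b^i+m∣high = subst (_∣ high) (trans (*-comm (b ^ m) (b ^ i)) (sym (^-distribˡ-+-* b i m)))
                       (*-monoˡ-∣ (b ^ i) b^m∣y/b^i)
    y≡high+low : y ≡ high + y % b ^ i
    y≡high+low = trans (m≡m%n+[m/n]*n y (b ^ i)) (+-comm (y % b ^ i) high)
    g^i+m∣low : g ^ (i + m) ∣ y % b ^ i
    g^i+m∣low = ∣m+n∣m⇒∣n (subst (g ^ (i + m) ∣_) y≡high+low g^i+m∣y)
                          (∣-trans (^-monoˡ-∣ (i + m) g∣b) b^i+m∣high)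
    b^i∣y : b ^ i ∣ y
    b^i∣y = m%n≡0⇒n∣m y (b ^ i) (∣∧<⇒≡0 g^i+m∣low (<-≤-trans (m%n<n y (b ^ i)) b^i≤g^i+m))

  module _ {g t J X : ℕ} (2≤g : 2 ≤ g) (g∣b : g ∣ b)
           (g^t∣X : g ^ t ∣ X) (b^J∤X : ¬ b ^ J ∣ X) where

    s*b^L≤t⇒L≤cb[X/b^s] : ∀ L s → J ≤ s → s * b ^ L ≤ t → L ≤ cb b (X /b^ s)
    s*b^L≤t⇒L≤cb[X/b^s] zero    s _   _        = z≤n
    s*b^L≤t⇒L≤cb[X/b^s] (suc L) s J≤s s*b^[1+L]≤t = begin-strict
      L                            ≤⟨ s*b^L≤t⇒L≤cb[X/b^s] L (s * b) J≤sb sb*b^L≤t ⟩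
      cb b (X /b^ (s * b))         ≡⟨ cong (cb b) (trans (cong (X /b^_) sb≡s+m) (sym (/b^-+ X s m))) ⟩
      cb b (X /b^ s /b^ m)         <⟨ cb-/b^< m (X /b^ s) b^m∤X/b^s ⟩
      cb b (X /b^ s)               ∎
      where
      open ≤-Reasoning
      m : ℕ
      m = s * suc k
      sb*b^L≤t : s * b * b ^ L ≤ t
      sb*b^L≤t = ≤-trans (≤-reflexive (*-assoc s b (b ^ L))) s*b^[1+L]≤t
      sb≡s+m : s * b ≡ s + m
      sb≡s+m = *-suc s (suc k)
      s≤sb : s ≤ s * b
      s≤sb = m≤m*n s b
      J≤sb : J ≤ s * b
      J≤sb = ≤-trans J≤s s≤sb
      sb≤t : s * b ≤ t
      sb≤t = ≤-trans (*-monoʳ-≤ s (m≤m*n b (b ^ L) {{b^≢0 L}})) s*b^[1+L]≤t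
      b^s≤g^s+m : b ^ s ≤ g ^ (s + m)
      b^s≤g^s+m = begin
        b ^ s        ≤⟨ ^-monoˡ-≤ s (<⇒≤ (n<m^n b 2≤g)) ⟩
        (g ^ b) ^ s  ≡⟨ ^-*-assoc g b s ⟩
        g ^ (b * s)  ≡⟨ cong (g ^_) (trans (*-comm b s) sb≡s+m) ⟩
        g ^ (s + m)  ∎
      g^s+m∣X : g ^ (s + m) ∣ X
      g^s+m∣X = ∣-trans (^-monoʳ-∣ g (≤-trans (≤-reflexive (sym sb≡s+m)) sb≤t)) g^t∣X
      b^m∤X/b^s : ¬ b ^ m ∣ X /b^ s
      b^m∤X/b^s b^m∣ = b^J∤X (∣-trans (^-monoʳ-∣ b (≤-trans J≤sb (≤-reflexive sb≡s+m)))
                                     (b^∣/b^⇒b^∣ s m g∣b b^s≤g^s+m g^s+m∣X b^m∣))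

    t<J*b^[1+cb] : t < J * b ^ suc (cb b X)
    t<J*b^[1+cb] with t <? J * b ^ suc (cb b X)
    ... | yes t< = t<
    ... | no  t≮ = contradiction (s*b^L≤t⇒L≤cb[X/b^s] (suc (cb b X)) J ≤-refl (≮⇒≥ t≮))
                                 (<⇒≱ (s≤s (cb-/b^≤ J X)))

    n<2^[[f*J*b+b]*cb] : ∀ {f n} → n < f * suc t → n < 2 ^ ((f * J * b + b) * cb b X)
    n<2^[[f*J*b+b]*cb] {f} {n} n<f[1+t] = begin-strict
      n                          <⟨ n<f[1+t] ⟩
      f * suc t                  ≤⟨ *-monoʳ-≤ f t<J*b^[1+cb] ⟩
      f * (J * (b * b ^ c))      ≡⟨ cong (f *_) (*-assoc J b (b ^ c)) ⟨
      f * (J * b * b ^ c)        ≡⟨ *-assoc f (J * b) (b ^ c) ⟨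
      f * (J * b) * b ^ c        ≡⟨ cong (_* b ^ c) (*-assoc f J b) ⟨
      f * J * b * b ^ c          ≤⟨ m*n^c≤2^[[m+n]*c] (f * J * b) b c (cb>0 0<X) ⟩
      2 ^ ((f * J * b + b) * c)  ∎
      where
      open ≤-Reasoning
      c : ℕ
      c = cb b X
      0<X : 0 < X
      0<X = n≢0⇒n>0 (λ X≡0 → b^J∤X (subst (b ^ J ∣_) (sym X≡0) ((b ^ J) ∣0)))

-- Primes and valuations

prime≥2 : ∀ {p} → Prime p → 2 ≤ p
prime≥2 {p} p-prime = nonTrivial⇒n>1 p {{prime⇒nonTrivial p-prime}}

prime∤1 : ∀ {p} → Prime p → ¬ p ∣ 1
prime∤1 p-prime p∣1 = contradiction (∣1⇒≡1 p∣1) (>⇒≢ (prime≥2 p-prime))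

∃prime∣ : ∀ {n} → 2 ≤ n → Σ ℕ λ p → Prime p × p ∣ n
∃prime∣ {n@(suc _)} 2≤n with factorise n
... | record { factors = [] ; isFactorisation = n≡1 } = contradiction n≡1 (>⇒≢ 2≤n)
... | record { factors = p ∷ ps ; isFactorisation = n≡ ; factorsPrime = p-prime ∷ _ } =
  p , p-prime , divides (product ps) (trans n≡ (*-comm p (product ps)))

prime∣^⇒∣ : ∀ {p m} n → Prime p → p ∣ m ^ n → p ∣ m
prime∣^⇒∣ zero    p-prime p∣1 = contradiction p∣1 (prime∤1 p-prime)
prime∣^⇒∣ {m = m} (suc n) p-prime p∣m^n+1 with euclidsLemma m (m ^ n) p-prime p∣m^n+1
... | inj₁ p∣m   = p∣m
... | inj₂ p∣m^n = prime∣^⇒∣ n p-prime p∣m^n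

prime∤⇒coprime : ∀ {p n} → Prime p → ¬ p ∣ n → Coprime p n
prime∤⇒coprime p-prime p∤n (i∣p , i∣n) with prime⇒irreducible p-prime i∣p
... | inj₁ i≡1    = i≡1
... | inj₂ refl   = contradiction i∣n p∤n

coprime-*ˡ : ∀ {m n o} → Coprime m o → Coprime n o → Coprime (m * n) o
coprime-*ˡ m⊥o n⊥o (i∣mn , i∣o) =
  n⊥o (coprime-divisor (λ (j∣i , j∣m) → m⊥o (j∣m , ∣-trans j∣i i∣o)) i∣mn , i∣o)

coprime-^ˡ : ∀ {m o} k → Coprime m o → Coprime (m ^ k) o
coprime-^ˡ {o = o} zero    _   = 1-coprimeTo o
coprime-^ˡ         (suc k) m⊥o = coprime-*ˡ m⊥o (coprime-^ˡ k m⊥o)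

record IsValuation (p x v : ℕ) : Set where
  constructor valuation
  field
    cofactor   : ℕ
    factorises : x ≡ p ^ v * cofactor
    p∤cofactor : ¬ p ∣ cofactor

module _ {p : ℕ} (p-prime : Prime p) where

  private instance
    p≢0 : NonZero p
    p≢0 = prime⇒nonZero p-prime

  valuation-∤ : ∀ {x} → ¬ p ∣ x → IsValuation p x 0
  valuation-∤ {x} p∤x = valuation x (sym (*-identityˡ x)) p∤x

  valuation-exists : ∀ {x} → 0 < x → Σ ℕ (IsValuation p x)
  valuation-exists {x} = <-rec (λ x → 0 < x → Σ ℕ (IsValuation p x)) step x
    where
    step : ∀ x → (∀ {y} → y < x → 0 < y → Σ ℕ (IsValuation p y)) →
           0 < x → Σ ℕ (IsValuation p x)
    step x rec 0<x with p ∣? x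
    ... | no  p∤x = 0 , valuation-∤ p∤x
    ... | yes (divides y x≡y*p) = extend (rec y<x 0<y)
      where
      0<y : 0 < y
      0<y = n≢0⇒n>0 (λ y≡0 → >⇒≢ 0<x (trans x≡y*p (cong (_* p) y≡0)))
      y<x : y < x
      y<x = subst (y <_) (sym x≡y*p) (m<m*n y p {{>-nonZero 0<y}} (prime≥2 p-prime))
      extend : Σ ℕ (IsValuation p y) → Σ ℕ (IsValuation p x)
      extend (v , valuation z y≡p^v*z p∤z) = suc v , valuation z x≡p^v+1*z p∤z
        where
        x≡p^v+1*z : x ≡ p ^ suc v * z
        x≡p^v+1*z = begin
          x                ≡⟨ x≡y*p ⟩
          y * p            ≡⟨ *-comm y p ⟩
          p * y            ≡⟨ cong (p *_) y≡p^v*z ⟩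
          p * (p ^ v * z)  ≡⟨ *-assoc p (p ^ v) z ⟨
          p ^ suc v * z    ∎
          where open ≡-Reasoning

  valuation⇒^∣ : ∀ {x v} e → e ≤ v → IsValuation p x v → p ^ e ∣ x
  valuation⇒^∣ {v = v} _ e≤v (valuation y x≡p^v*y _) =
    ∣-trans (^-monoʳ-∣ p e≤v) (divides y (trans x≡p^v*y (*-comm (p ^ v) y)))

  ^∣⇒≤valuation : ∀ {x v} e → IsValuation p x v → p ^ e ∣ x → e ≤ v
  ^∣⇒≤valuation {x} {v} e (valuation y x≡p^v*y p∤y) p^e∣x with e ≤? v
  ... | yes e≤v = e≤v
  ... | no  e≰v = contradiction (*-cancelˡ-∣ (p ^ v) {{m^n≢0 p v}} p^v*p∣p^v*y) p∤y
    where
    p^v*p∣p^v*y : p ^ v * p ∣ p ^ v * y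
    p^v*p∣p^v*y = subst₂ _∣_ (*-comm p (p ^ v)) x≡p^v*y (∣-trans (^-monoʳ-∣ p (≰⇒> e≰v)) p^e∣x)

  ∣⇒valuation>0 : ∀ {x v} → p ∣ x → IsValuation p x v → 0 < v
  ∣⇒valuation>0 {x} p∣x x:v = ^∣⇒≤valuation 1 x:v (subst (_∣ x) (sym (*-identityʳ p)) p∣x)

  valuation-unique : ∀ {x v w} → IsValuation p x v → IsValuation p x w → v ≡ w
  valuation-unique x:v x:w = ≤-antisym (^∣⇒≤valuation _ x:w (valuation⇒^∣ _ ≤-refl x:v))
                                       (^∣⇒≤valuation _ x:v (valuation⇒^∣ _ ≤-refl x:w))

  valuation-* : ∀ {x y v w} → IsValuation p x v → IsValuation p y w → IsValuation p (x * y) (v + w)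
  valuation-* {x} {y} {v} {w} (valuation x' x≡ p∤x') (valuation y' y≡ p∤y') =
    valuation (x' * y') xy≡ p∤x'y'
    where
    xy≡ : x * y ≡ p ^ (v + w) * (x' * y')
    xy≡ = begin
      x * y                          ≡⟨ cong₂ _*_ x≡ y≡ ⟩
      p ^ v * x' * (p ^ w * y')      ≡⟨ interchange (p ^ v) x' (p ^ w) y' ⟩
      p ^ v * p ^ w * (x' * y')      ≡⟨ cong (_* (x' * y')) (^-distribˡ-+-* p v w) ⟨
      p ^ (v + w) * (x' * y')        ∎
      where open ≡-Reasoning
    p∤x'y' : ¬ p ∣ x' * y'
    p∤x'y' p∣x'y' with euclidsLemma x' y' p-prime p∣x'y'
    ... | inj₁ p∣x' = p∤x' p∣x'
    ... | inj₂ p∣y' = p∤y' p∣y'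

  valuation-^ : ∀ {x v} n → IsValuation p x v → IsValuation p (x ^ n) (n * v)
  valuation-^ zero    _   = valuation-∤ (prime∤1 p-prime)
  valuation-^ (suc n) x:v = valuation-* x:v (valuation-^ n x:v)

-- Split off the exact power p ^ v of a prime factor p of x; the rest is smaller and coprime to p ^ v.
∣-by-prime-powers : ∀ {x y} → 0 < x → (∀ p e → Prime p → p ^ e ∣ x → p ^ e ∣ y) → x ∣ y
∣-by-prime-powers {x} {y} = <-rec Goal step x
  where
  Goal : ℕ → Set
  Goal x = 0 < x → (∀ p e → Prime p → p ^ e ∣ x → p ^ e ∣ y) → x ∣ y
  step : ∀ x → (∀ {x'} → x' < x → Goal x') → Goal x
  step (suc zero)       _   _   _      = 1∣ y
  step x@(suc (suc _))  rec 0<x x-dvd with ∃prime∣ {x} (s≤s (s≤s z≤n))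
  ... | p , p-prime , p∣x with valuation-exists p-prime 0<x
  ... | v , x:v@(valuation x' x≡p^v*x' p∤x')
    with x-dvd p v p-prime (valuation⇒^∣ p-prime v ≤-refl x:v)
  ...   | divides y' y≡y'*p^v = subst₂ _∣_ (sym x≡p^v*x') (sym (trans y≡y'*p^v (*-comm y' (p ^ v))))
                                       (*-monoʳ-∣ (p ^ v) x'∣y')
    where
    0<x' : 0 < x'
    0<x' = n≢0⇒n>0 λ x'≡0 → >⇒≢ 0<x (trans x≡p^v*x' (trans (cong (p ^ v *_) x'≡0) (*-zeroʳ (p ^ v))))
    1<p^v : 1 < p ^ v
    1<p^v = <-≤-trans (prime≥2 p-prime) (≤-trans (≤-reflexive (sym (*-identityʳ p)))
              (^-monoʳ-≤ p {{prime⇒nonZero p-prime}} (∣⇒valuation>0 p-prime p∣x x:v)))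
    x'<x : x' < x
    x'<x = subst (x' <_) (trans (*-comm x' (p ^ v)) (sym x≡p^v*x'))
                 (m<m*n x' (p ^ v) {{>-nonZero 0<x'}} 1<p^v)
    x'∣y : x' ∣ y
    x'∣y = rec x'<x 0<x' λ p' e p'-prime p'^e∣x' →
      x-dvd p' e p'-prime (∣-trans p'^e∣x' (divides (p ^ v) x≡p^v*x'))
    x'∣y' : x' ∣ y'
    x'∣y' = coprime-divisor (Coprimality.sym (coprime-^ˡ v (prime∤⇒coprime p-prime p∤x')))
                            (subst (x' ∣_) (trans y≡y'*p^v (*-comm y' (p ^ v))) x'∣y)

-- The prime factor of b of least ratio ν_p(d) / ν_p(b)

module _ {P : ℕ → Set} (P? : Decidable P) {_≼_ : ℕ → ℕ → Set}
         (≼-total : ∀ {x y} → P x → P y → x ≼ y ⊎ y ≼ x)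
         (≼-trans : ∀ {x y z} → P y → x ≼ y → y ≼ z → x ≼ z) where

  private
    ≼-refl : ∀ {x} → P x → x ≼ x
    ≼-refl Px with ≼-total Px Px
    ... | inj₁ x≼x = x≼x
    ... | inj₂ x≼x = x≼x

    extend : ∀ {m M} → (∀ {y} → y < M → P y → m ≼ y) → (P M → m ≼ M) →
             ∀ {y} → y < suc M → P y → m ≼ y
    extend least m≼M (s≤s y≤M) Py with m≤n⇒m<n∨m≡n y≤M
    ... | inj₁ y<M  = least y<M Py
    ... | inj₂ refl = m≼M Py

  ∃-least-below : ∀ {x} → P x → ∀ M → Σ ℕ λ m → P m × (∀ {y} → y < M → P y → m ≼ y)
  ∃-least-below Px zero = _ , Px , λ ()
  ∃-least-below Px (suc M) with ∃-least-below Px M | P? M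
  ... | m , Pm , least | no ¬PM = m , Pm , extend least (λ PM → contradiction PM ¬PM)
  ... | m , Pm , least | yes PM with ≼-total Pm PM
  ...   | inj₁ m≼M = m , Pm , extend least (λ _ → m≼M)
  ...   | inj₂ M≼m = M , PM , extend (λ y<M Py → ≼-trans Pm M≼m (least y<M Py)) ≼-refl

  ∃-least : ∀ {x B} → P x → (∀ {y} → P y → y < B) → Σ ℕ λ m → P m × (∀ {y} → P y → m ≼ y)
  ∃-least {B = B} Px bounded with ∃-least-below Px B
  ... | m , Pm , least = m , Pm , λ Py → least (bounded Py) Py

module RatioOrder {d b : ℕ} (0<d : 0 < d) (0<b : 0 < b) where

  PrimeFactor : ℕ → Set
  PrimeFactor p = Prime p × p ∣ b

  -- p ≼ p' iff ν_p(d) / ν_p(b) ≤ ν_p'(d) / ν_p'(b)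
  _≼_ : ℕ → ℕ → Set
  p ≼ p' = ∀ {e f e' f'} → IsValuation p d e → IsValuation p b f →
           IsValuation p' d e' → IsValuation p' b f' → e * f' ≤ e' * f

  ≼-intro : ∀ {p p' e f e' f'} → Prime p → Prime p' →
            IsValuation p d e → IsValuation p b f → IsValuation p' d e' → IsValuation p' b f' →
            e * f' ≤ e' * f → p ≼ p'
  ≼-intro pp pp' d:e b:f d:e' b:f' ef'≤e'f d:ê b:f̂ d:ê' b:f̂'
    rewrite valuation-unique pp d:ê d:e | valuation-unique pp b:f̂ b:f
          | valuation-unique pp' d:ê' d:e' | valuation-unique pp' b:f̂' b:f' = ef'≤e'f

  ≼-total : ∀ {p p'} → PrimeFactor p → PrimeFactor p' → p ≼ p' ⊎ p' ≼ p
  ≼-total (pp , _) (pp' , _)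
    with valuation-exists pp 0<d | valuation-exists pp 0<b
       | valuation-exists pp' 0<d | valuation-exists pp' 0<b
  ... | e , d:e | f , b:f | e' , d:e' | f' , b:f' with e * f' ≤? e' * f
  ...   | yes ef'≤e'f = inj₁ (≼-intro pp pp' d:e b:f d:e' b:f' ef'≤e'f)
  ...   | no  ef'≰e'f = inj₂ (≼-intro pp' pp d:e' b:f' d:e b:f (≰⇒≥ ef'≰e'f))

  ≼-trans : ∀ {p p' p''} → PrimeFactor p' → p ≼ p' → p' ≼ p'' → p ≼ p''
  ≼-trans (pp' , p'∣b) p≼p' p'≼p'' {e} {f} {e''} {f''} d:e b:f d:e'' b:f''
    with valuation-exists pp' 0<d | valuation-exists pp' 0<b
  ... | e' , d:e' | f' , b:f' =
    frac-≤-trans e f e' f' e'' f'' (∣⇒valuation>0 pp' p'∣b b:f')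
                 (p≼p' d:e b:f d:e' b:f') (p'≼p'' d:e' b:f' d:e'' b:f'')

record PowerSplitting (d b : ℕ) : Set where
  field
    p e f F   : ℕ
    p-prime   : Prime p
    p∣b       : p ∣ b
    d:e       : IsValuation p d e
    0<f       : 0 < f
    d^f≡F*b^e : d ^ f ≡ F * b ^ e
    p∤F       : ¬ p ∣ F

module _ {d b : ℕ} (0<d : 0 < d) (2≤b : 2 ≤ b) where

  private
    0<b : 0 < b
    0<b = ≤-trans (s≤s z≤n) 2≤b
    open RatioOrder 0<d 0<b

  power-splitting : PowerSplitting d b
  power-splitting with ∃prime∣ 2≤b
  ... | p₀ , p₀-prime , p₀∣b
    with ∃-least (λ p → prime? p ×-dec p ∣? b) ≼-total ≼-trans (p₀-prime , p₀∣b)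
                 (λ (_ , p∣b) → s≤s (∣⇒≤ {{>-nonZero 0<b}} p∣b))
  ... | p , (pp , p∣b) , least with valuation-exists pp 0<d | valuation-exists pp 0<b
  ... | e , d:e | f , b:f = record
    { p = p ; e = e ; f = f ; F = _∣_.quotient b^e∣d^f ; p-prime = pp ; p∣b = p∣b ; d:e = d:e
    ; 0<f = ∣⇒valuation>0 pp p∣b b:f ; d^f≡F*b^e = _∣_.equality b^e∣d^f ; p∤F = p∤F }
    where
    b^e∣d^f : b ^ e ∣ d ^ f
    b^e∣d^f = ∣-by-prime-powers (m^n>0 b {{>-nonZero 0<b}} e) prime-powers
      where
      prime-powers : ∀ q j → Prime q → q ^ j ∣ b ^ e → q ^ j ∣ d ^ f
      prime-powers q zero    _  _ = 1∣ _
      prime-powers q (suc j) qp q^j+1∣b^e with valuation-exists qp 0<d | valuation-exists qp 0<b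
      ... | e' , d:e' | f' , b:f' = valuation⇒^∣ qp (suc j) (begin
        suc j   ≤⟨ ^∣⇒≤valuation qp (suc j) (valuation-^ qp e b:f') q^j+1∣b^e ⟩
        e * f'  ≤⟨ least (qp , q∣b) d:e b:f d:e' b:f' ⟩
        e' * f  ≡⟨ *-comm e' f ⟩
        f * e'  ∎) (valuation-^ qp f d:e')
        where
        open ≤-Reasoning
        q∣b : q ∣ b
        q∣b = prime∣^⇒∣ e qp (∣-trans (m∣m*n (q ^ j)) q^j+1∣b^e)
    -- ν_p(d ^ f) = f e = ν_p(b ^ e)
    p∤F : ¬ p ∣ _∣_.quotient b^e∣d^f
    p∤F p∣F = contradiction (*-comm e f) (<⇒≢ (^∣⇒≤valuation pp (suc (e * f)) (valuation-^ pp f d:e)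
      (subst (p ^ suc (e * f) ∣_) (sym (_∣_.equality b^e∣d^f))
        (*-pres-∣ p∣F (valuation⇒^∣ pp (e * f) ≤-refl (valuation-^ pp e b:f))))))

-- Powers of a

smallest⇒prime∣⇒∣b : ∀ {a b d p} → IsSmallestCoprimeCofactorDivisor a b d →
                     Prime p → p ∣ d → p ∣ b
smallest⇒prime∣⇒∣b {a} {b} {d} {p} ((0<d , q , a≡q*d , q⊥b) , smallest) p-prime (divides d' d≡d'*p)
  with p ∣? b
... | yes p∣b = p∣b
... | no  p∤b = contradiction (smallest d' d'-admissible) (<⇒≱ d'<d)
  where
  0<d' : 0 < d'
  0<d' = n≢0⇒n>0 (λ d'≡0 → >⇒≢ 0<d (trans d≡d'*p (cong (_* p) d'≡0)))
  d'<d : d' < d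
  d'<d = subst (d' <_) (sym d≡d'*p) (m<m*n d' p {{>-nonZero 0<d'}} (prime≥2 p-prime))
  d'-admissible : Admissible a b d'
  d'-admissible = 0<d' , q * p , trans a≡q*d (trans (cong (q *_) d≡d'*p) (x∙yz≈xz∙y q d' p)) ,
                  coprime⇒gcd≡1 qp⊥b
    where
    qp⊥b : Coprime (q * p) b
    qp⊥b = coprime-*ˡ (gcd≡1⇒coprime {q} {b} q⊥b) (prime∤⇒coprime p-prime p∤b)

splitting-cofactor≥2 : ∀ {d b} → 0 < d → LogRatioIrrational d b →
                       (s : PowerSplitting d b) → 2 ≤ PowerSplitting.F s
splitting-cofactor≥2 0<d irrational s with PowerSplitting.F s | PowerSplitting.d^f≡F*b^e s
... | zero        | d^f≡0     = contradiction (m^n≡0⇒m≡0 _ (PowerSplitting.f s) d^f≡0) (>⇒≢ 0<d)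
... | suc zero    | d^f≡1*b^e = contradiction (e , f , 0<f , trans d^f≡1*b^e (*-identityˡ _)) irrational
  where open PowerSplitting s using (e; f; 0<f)
... | suc (suc _) | _         = s≤s (s≤s z≤n)

module PowerOfA {a b d q : ℕ} (s : PowerSplitting d b) (a≡q*d : a ≡ q * d)
                (p∤q : ¬ PowerSplitting.p s ∣ q) (n : ℕ) where
  open PowerSplitting s

  private instance
    f≢0 : NonZero f
    f≢0 = >-nonZero 0<f

  t r X : ℕ
  t = n / f
  r = n % f
  X = q ^ n * (d ^ r * F ^ t)

  n≡r+tf : n ≡ r + t * f
  n≡r+tf = m≡m%n+[m/n]*n n f

  a^n≡X*b^et : a ^ n ≡ X * b ^ (e * t)
  a^n≡X*b^et = begin
    a ^ n                                  ≡⟨ cong (_^ n) a≡q*d ⟩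
    (q * d) ^ n                            ≡⟨ ^-distribʳ-* q d n ⟩
    q ^ n * d ^ n                          ≡⟨ cong (λ i → q ^ n * d ^ i) n≡r+tf ⟩
    q ^ n * d ^ (r + t * f)                ≡⟨ cong (q ^ n *_) (^-split b e r t d^f≡F*b^e) ⟩
    q ^ n * (d ^ r * F ^ t * b ^ (e * t))  ≡⟨ *-assoc (q ^ n) (d ^ r * F ^ t) (b ^ (e * t)) ⟨
    X * b ^ (e * t)                        ∎
    where open ≡-Reasoning

  F^t∣X : F ^ t ∣ X
  F^t∣X = ∣-trans (n∣m*n (d ^ r)) (n∣m*n (q ^ n))

  X:n*0+[r*e+t*0] : IsValuation p X (n * 0 + (r * e + t * 0))
  X:n*0+[r*e+t*0] = valuation-* p-prime (valuation-^ p-prime n (valuation-∤ p-prime p∤q))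
    (valuation-* p-prime (valuation-^ p-prime r d:e) (valuation-^ p-prime t (valuation-∤ p-prime p∤F)))

  b^[1+fe]∤X : ¬ b ^ suc (f * e) ∣ X
  b^[1+fe]∤X b^[1+fe]∣X = n≮n (f * e) (begin-strict
    f * e                        <⟨ ^∣⇒≤valuation p-prime (suc (f * e)) X:n*0+[r*e+t*0] p^[1+fe]∣X ⟩
    n * 0 + (r * e + t * 0)      ≡⟨ cong₂ (λ x y → x + (r * e + y)) (*-zeroʳ n) (*-zeroʳ t) ⟩
    r * e + 0                    ≡⟨ +-identityʳ (r * e) ⟩
    r * e                        ≤⟨ *-monoˡ-≤ e (<⇒≤ (m%n<n n f)) ⟩
    f * e                        ∎)
    where
    open ≤-Reasoning
    p^[1+fe]∣X : p ^ suc (f * e) ∣ X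
    p^[1+fe]∣X = ∣-trans (^-monoˡ-∣ (suc (f * e)) p∣b) b^[1+fe]∣X

  n<f[1+t] : n < f * suc t
  n<f[1+t] = begin-strict
    n          ≡⟨ n≡r+tf ⟩
    r + t * f  <⟨ +-monoˡ-< (t * f) (m%n<n n f) ⟩
    f + t * f  ≡⟨ *-comm (suc t) f ⟩
    f * suc t  ∎
    where open ≤-Reasoning

record GrowingFactorDecomposition (a b : ℕ) : Set where
  field
    g f J     : ℕ
    2≤g       : 2 ≤ g
    g∣b       : g ∣ b
    decompose : ∀ n → Σ ℕ λ X → Σ ℕ λ t → Σ ℕ λ i →
                a ^ n ≡ X * b ^ i × g ^ t ∣ X × ¬ b ^ J ∣ X × n < f * suc t

growing-factor-decomposition : ∀ {a b d} → 2 ≤ b → IsSmallestCoprimeCofactorDivisor a b d →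
                               LogRatioIrrational d b → GrowingFactorDecomposition a b
growing-factor-decomposition {a} {b} {d} 2≤b smallest@((0<d , q , a≡q*d , q⊥b) , _) irrational
  with power-splitting 0<d 2≤b
... | s with ∃prime∣ (splitting-cofactor≥2 0<d irrational s)
... | g , g-prime , g∣F = record
  { g = g ; f = f ; J = suc (f * e) ; 2≤g = prime≥2 g-prime
  ; g∣b = smallest⇒prime∣⇒∣b smallest g-prime (prime∣^⇒∣ f g-prime (∣-trans g∣F F∣d^f))
  ; decompose = λ n → let open PowerOfA s a≡q*d p∤q n in
      X , t , e * t , a^n≡X*b^et , ∣-trans (^-monoˡ-∣ t g∣F) F^t∣X , b^[1+fe]∤X , n<f[1+t] }
  where
  open PowerSplitting s
  F∣d^f : F ∣ d ^ f
  F∣d^f = divides (b ^ e) (trans d^f≡F*b^e (*-comm F (b ^ e)))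
  p∤q : ¬ p ∣ q
  p∤q p∣q = prime∤1 p-prime (subst (p ∣_) q⊥b (gcd-greatest p∣q p∣b))

module _ {a k : ℕ} (D : GrowingFactorDecomposition a (suc (suc k))) where
  open GrowingFactorDecomposition D
  open BaseDigits k using (b; cb-*b^; n<2^[[f*J*b+b]*cb])

  n<2^[[f*J*b+b]*cb[a^n]] : ∀ n → n < 2 ^ ((f * J * b + b) * cb b (a ^ n))
  n<2^[[f*J*b+b]*cb[a^n]] n with decompose n
  ... | X , t , i , a^n≡X*b^i , g^t∣X , b^J∤X , n<f[1+t] =
    subst (λ y → n < 2 ^ ((f * J * b + b) * y))
          (trans (sym (cb-*b^ i X)) (cong (cb b) (sym a^n≡X*b^i)))
          (n<2^[[f*J*b+b]*cb] {t = t} {J} 2≤g g∣b g^t∣X b^J∤X {f} n<f[1+t])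

theorem4p4 : (a b d : ℕ) → 2 ≤ a → 2 ≤ b →
    IsSmallestCoprimeCofactorDivisor a b d →
    LogRatioIrrational d b →
    Σ ℕ (λ K → (1 ≤ K) × Σ ℕ (λ N → (n : ℕ) → N ≤ n → n < 2 ^ (K * cb b (a ^ n))))
theorem4p4 a b d _ 2≤b@(s≤s (s≤s {n = k} z≤n)) smallest irrational =
  f * J * b + b , ≤-trans (s≤s z≤n) (m≤n+m b (f * J * b)) , 0 , λ n _ → n<2^[[f*J*b+b]*cb[a^n]] D n
  where
  D : GrowingFactorDecomposition a b
  D = growing-factor-decomposition 2≤b smallest irrational
  open GrowingFactorDecomposition D using (f; J)
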